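{- $(\mathcal P_\in,\leq_\in)$ is a partially ordered set.
   Context: Work in the universe of hereditarily finite sets built from a single atom (urelement) $\heartsuit$. For a set $M$ put $M_L=\{A\in M : A \text{ a set},\ \heartsuit\notin A\}$ and $M_R=\{A : A\text{ a set},\ \heartsuit\notin A,\ A\cup\{\heartsuit\}\in M\}$. The class $\mathcal P_\in$ is defined recursively: a set $M$ belongs to $\mathcal P_\in$ iff (a) $\heartsuit\notin M$; (b) $M_L\cup M_R\subseteq\mathcal P_\in$; (c) $M_L\cap M_R=\emptyset$; (d) $(\{A\}\cup A_R)\cap(\{B\}\cup B_L)\ne\emptyset$ for all $A\in M_L$, $B\in M_R$; (e) $A_L\subseteq M_L$ for each $A\in M_L$; (f) $B_R\subseteq M_R$ for each $B\in M_R$. For $M,N\in\mathcal P_\in$ put $M<_\in N$ iff $(\{M\}\cup M_R)\cap(\{N\}\cup N_L)\neq\emptyset$, and $M\leq_\in N$ iff $M<_\in N$ or $M=N$. -}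

module Defs where

open import Data.List using (List; []; _∷_)
open import Data.Unit using (⊤)
open import Data.Empty using (⊥)
open import Data.Product using (Σ; _×_; ∃-syntax; proj₁)
open import Data.Sum using (_⊎_)
open import Relation.Nullary using (¬_)

-- Hereditarily finite sets over the single atom ♥, represented by
-- finite trees; set equality is extensional equality _≈_ below.
data HF : Set where
  ♥   : HF
  set : List HF → HF

mutual
  _≈_ : HF → HF → Set
  ♥ ≈ ♥ = ⊤
  ♥ ≈ set _ = ⊥
  set _ ≈ ♥ = ⊥
  set xs ≈ set ys = (xs ⊆L ys) × (ys ⊆L xs)

  _⊆L_ : List HF → List HF → Set
  [] ⊆L ys = ⊤
  (x ∷ xs) ⊆L ys = (x ∈L ys) × (xs ⊆L ys)

  _∈L_ : HF → List HF → Set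
  x ∈L [] = ⊥
  x ∈L (y ∷ ys) = (x ≈ y) ⊎ (x ∈L ys)

infix 4 _≈_ _∈_

_∈_ : HF → HF → Set
x ∈ ♥ = ⊥
x ∈ set ms = x ∈L ms

IsSet : HF → Set
IsSet ♥ = ⊥
IsSet (set _) = ⊤

-- A ∪ {♥} (only used for sets A)
addHeart : HF → HF
addHeart ♥ = ♥
addHeart (set as) = set (♥ ∷ as)

InL : HF → HF → Set
InL M A = (A ∈ M) × IsSet A × ¬ (♥ ∈ A)

InR : HF → HF → Set
InR M A = IsSet A × ¬ (♥ ∈ A) × (addHeart A ∈ M)

Meet : HF → HF → Set
Meet A B = ∃[ C ] (((C ≈ A) ⊎ InR A C) × ((C ≈ B) ⊎ InL B C))

-- the class 𝒫_∈ (inductive = recursive definition, since it is well-founded)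
data P∈ : HF → Set where
  mkP : (M : HF) →
        IsSet M →
        ¬ (♥ ∈ M) →
        (∀ A → InL M A → P∈ A) → (∀ A → InR M A → P∈ A) →
        (∀ A → InL M A → InR M A → ⊥) →                             -- (c)
        (∀ A B → InL M A → InR M B → Meet A B) →                    -- (d)
        (∀ A → InL M A → ∀ C → InL A C → InL M C) →                 -- (e)
        (∀ B → InR M B → ∀ C → InR B C → InR M C) →                 -- (f)
        P∈ M

𝒫 : Set
𝒫 = Σ HF P∈

_≈𝒫_ : 𝒫 → 𝒫 → Set
M ≈𝒫 N = proj₁ M ≈ proj₁ N

_<∈_ : 𝒫 → 𝒫 → Set
M <∈ N = Meet (proj₁ M) (proj₁ N)

_≤∈_ : 𝒫 → 𝒫 → Set
M ≤∈ N = (M <∈ N) ⊎ (M ≈𝒫 N)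

module Submission where

-- Write L⁼ M = {M} ∪ M_L and R⁼ M = {M} ∪ M_R, so that M <∈ N means R⁼ M ∩ L⁼ N ≠ ∅.
-- Condition (d) for N extends to: any C ∈ L⁼ N and D ∈ R⁼ N meet, i.e. some
-- E ∈ R⁼ C ∩ L⁼ D; and (e), (f) make L⁼ and R⁼ transitive. Transitivity: from
-- C ∈ R⁼ M ∩ L⁼ N and D ∈ R⁼ N ∩ L⁼ K, such an E lies in R⁼ M ∩ L⁼ K.
-- Antisymmetry: take K = M. Then E ∈ R⁼ M ∩ L⁼ M, which is {M} by (c) and since
-- M ∉ M_L, M ∉ M_R (well-foundedness). So M ∈ L⁼ D while D ∈ L⁼ M, forcing D = M;
-- the same argument with the roles of M and N exchanged gives D = N.

open import Defs
open import Data.List using ([]; _∷_)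
open import Data.Unit using (tt)
open import Data.Empty using (⊥-elim)
open import Data.Product using (_,_; proj₁; proj₂)
open import Data.Sum using (_⊎_; inj₁; inj₂)
open import Relation.Nullary using (¬_)
open import Relation.Binary.Structures using (IsEquivalence; IsPartialOrder)
import Relation.Binary.Construct.On as On

⊆L-weaken : ∀ xs y ys → xs ⊆L ys → xs ⊆L (y ∷ ys)
⊆L-weaken []       y ys _       = tt
⊆L-weaken (x ∷ xs) y ys (x∈ , r) = inj₂ x∈ , ⊆L-weaken xs y ys r

mutual
  ≈-refl : ∀ x → x ≈ x
  ≈-refl ♥        = tt
  ≈-refl (set xs) = ⊆L-refl xs , ⊆L-refl xs

  ⊆L-refl : ∀ xs → xs ⊆L xs
  ⊆L-refl []       = tt
  ⊆L-refl (x ∷ xs) = inj₁ (≈-refl x) , ⊆L-weaken xs x xs (⊆L-refl xs)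

≈-sym : ∀ x y → x ≈ y → y ≈ x
≈-sym ♥        ♥        _       = tt
≈-sym (set xs) (set ys) (l , r) = r , l

mutual
  ≈-trans : ∀ x y z → x ≈ y → y ≈ z → x ≈ z
  ≈-trans ♥        ♥        ♥        _         _         = tt
  ≈-trans (set xs) (set ys) (set zs) (xy , yx) (yz , zy) =
    ⊆L-trans xs ys zs xy yz , ⊆L-trans zs ys xs zy yx

  ∈L-resp-≈ : ∀ x y zs → x ≈ y → y ∈L zs → x ∈L zs
  ∈L-resp-≈ x y (z ∷ zs) x≈y (inj₁ y≈z) = inj₁ (≈-trans x y z x≈y y≈z)
  ∈L-resp-≈ x y (z ∷ zs) x≈y (inj₂ y∈) = inj₂ (∈L-resp-≈ x y zs x≈y y∈)

  ∈L-resp-⊆L : ∀ x ys zs → x ∈L ys → ys ⊆L zs → x ∈L zs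
  ∈L-resp-⊆L x (y ∷ ys) zs (inj₁ x≈y) (y∈ , _) = ∈L-resp-≈ x y zs x≈y y∈
  ∈L-resp-⊆L x (y ∷ ys) zs (inj₂ x∈) (_ , ys⊆) = ∈L-resp-⊆L x ys zs x∈ ys⊆

  ⊆L-trans : ∀ xs ys zs → xs ⊆L ys → ys ⊆L zs → xs ⊆L zs
  ⊆L-trans []       ys zs _         _  = tt
  ⊆L-trans (x ∷ xs) ys zs (x∈ , xs⊆) ys⊆ =
    ∈L-resp-⊆L x ys zs x∈ ys⊆ , ⊆L-trans xs ys zs xs⊆ ys⊆

≈-isEquivalence : IsEquivalence _≈_
≈-isEquivalence = record
  { refl  = λ {x} → ≈-refl x
  ; sym   = λ {x} {y} → ≈-sym x y
  ; trans = λ {x} {y} {z} → ≈-trans x y z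
  }

∈-respʳ-≈ : ∀ x A B → A ≈ B → x ∈ A → x ∈ B
∈-respʳ-≈ x (set as) (set bs) (as⊆bs , _) x∈ = ∈L-resp-⊆L x as bs x∈ as⊆bs

∈-respˡ-≈ : ∀ M x y → x ≈ y → x ∈ M → y ∈ M
∈-respˡ-≈ (set ms) x y x≈y x∈ = ∈L-resp-≈ y x ms (≈-sym x y x≈y) x∈

IsSet-resp-≈ : ∀ x y → x ≈ y → IsSet x → IsSet y
IsSet-resp-≈ (set _) (set _) _ _ = tt

♥∉-resp-≈ : ∀ x y → x ≈ y → ¬ (♥ ∈ x) → ¬ (♥ ∈ y)
♥∉-resp-≈ x y x≈y ♥∉x ♥∈y = ♥∉x (∈-respʳ-≈ ♥ y x (≈-sym x y x≈y) ♥∈y)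

addHeart-cong : ∀ x y → x ≈ y → addHeart x ≈ addHeart y
addHeart-cong ♥        ♥        _         = tt
addHeart-cong (set xs) (set ys) (xy , yx) =
  (inj₁ tt , ⊆L-weaken xs ♥ ys xy) , (inj₁ tt , ⊆L-weaken ys ♥ xs yx)

InL-respˡ : ∀ M M' A → M ≈ M' → InL M A → InL M' A
InL-respˡ M M' A M≈M' (A∈ , s , ♥∉) = ∈-respʳ-≈ A M M' M≈M' A∈ , s , ♥∉

InL-respʳ : ∀ M A B → A ≈ B → InL M A → InL M B
InL-respʳ M A B A≈B (A∈ , s , ♥∉) =
  ∈-respˡ-≈ M A B A≈B A∈ , IsSet-resp-≈ A B A≈B s , ♥∉-resp-≈ A B A≈B ♥∉

InR-respˡ : ∀ M M' A → M ≈ M' → InR M A → InR M' A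
InR-respˡ M M' A M≈M' (s , ♥∉ , A♥∈) = s , ♥∉ , ∈-respʳ-≈ (addHeart A) M M' M≈M' A♥∈

InR-respʳ : ∀ M A B → A ≈ B → InR M A → InR M B
InR-respʳ M A B A≈B (s , ♥∉ , A♥∈) =
  IsSet-resp-≈ A B A≈B s , ♥∉-resp-≈ A B A≈B ♥∉ ,
  ∈-respˡ-≈ M (addHeart A) (addHeart B) (addHeart-cong A B A≈B) A♥∈

InL⁼ : HF → HF → Set
InL⁼ M C = (C ≈ M) ⊎ InL M C

InR⁼ : HF → HF → Set
InR⁼ M C = (C ≈ M) ⊎ InR M C

InL⁼-respʳ : ∀ M A B → A ≈ B → InL⁼ M A → InL⁼ M B
InL⁼-respʳ M A B A≈B (inj₁ A≈M) = inj₁ (≈-trans B A M (≈-sym A B A≈B) A≈M)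
InL⁼-respʳ M A B A≈B (inj₂ MA)  = inj₂ (InL-respʳ M A B A≈B MA)

InR⁼-respʳ : ∀ M A B → A ≈ B → InR⁼ M A → InR⁼ M B
InR⁼-respʳ M A B A≈B (inj₁ A≈M) = inj₁ (≈-trans B A M (≈-sym A B A≈B) A≈M)
InR⁼-respʳ M A B A≈B (inj₂ MA)  = inj₂ (InR-respʳ M A B A≈B MA)

P∈-disjoint : ∀ {M} → P∈ M → ∀ A → InL M A → ¬ InR M A
P∈-disjoint (mkP _ _ _ _ _ disjoint _ _ _) = disjoint

P∈-meet : ∀ {M} → P∈ M → ∀ A B → InL M A → InR M B → Meet A B
P∈-meet (mkP _ _ _ _ _ _ meet _ _) = meet

P∈-closedˡ : ∀ {M} → P∈ M → ∀ A → InL M A → ∀ C → InL A C → InL M C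
P∈-closedˡ (mkP _ _ _ _ _ _ _ closed _) = closed

P∈-closedʳ : ∀ {M} → P∈ M → ∀ B → InR M B → ∀ C → InR B C → InR M C
P∈-closedʳ (mkP _ _ _ _ _ _ _ _ closed) = closed

InL-irrefl : ∀ {M} → P∈ M → ¬ InL M M
InL-irrefl {M} (mkP _ _ _ P∈ˡ _ _ _ _ _) MM = InL-irrefl (P∈ˡ M MM) MM

InR-irrefl : ∀ {M} → P∈ M → ¬ InR M M
InR-irrefl {M} (mkP _ _ _ _ P∈ʳ _ _ _ _) MM = InR-irrefl (P∈ʳ M MM) MM

InL⁼-trans : ∀ {M} → P∈ M → ∀ A B → InL⁼ M A → InL⁼ A B → InL⁼ M B
InL⁼-trans {M} p A B MA         (inj₁ B≈A) = InL⁼-respʳ M A B (≈-sym B A B≈A) MA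
InL⁼-trans {M} p A B (inj₁ A≈M) (inj₂ AB)  = inj₂ (InL-respˡ A M B A≈M AB)
InL⁼-trans {M} p A B (inj₂ MA)  (inj₂ AB)  = inj₂ (P∈-closedˡ p A MA B AB)

InR⁼-trans : ∀ {M} → P∈ M → ∀ A B → InR⁼ M A → InR⁼ A B → InR⁼ M B
InR⁼-trans {M} p A B MA         (inj₁ B≈A) = InR⁼-respʳ M A B (≈-sym B A B≈A) MA
InR⁼-trans {M} p A B (inj₁ A≈M) (inj₂ AB)  = inj₂ (InR-respˡ A M B A≈M AB)
InR⁼-trans {M} p A B (inj₂ MA)  (inj₂ AB)  = inj₂ (P∈-closedʳ p A MA B AB)

InL⁼-antisym : ∀ {M} → P∈ M → ∀ A → InL⁼ M A → InL⁼ A M → A ≈ M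
InL⁼-antisym {M} p A (inj₁ A≈M) _          = A≈M
InL⁼-antisym {M} p A (inj₂ _)   (inj₁ M≈A) = ≈-sym M A M≈A
InL⁼-antisym {M} p A (inj₂ MA)  (inj₂ AM)  = ⊥-elim (InL-irrefl p (P∈-closedˡ p A MA M AM))

InR⁼-antisym : ∀ {M} → P∈ M → ∀ A → InR⁼ M A → InR⁼ A M → A ≈ M
InR⁼-antisym {M} p A (inj₁ A≈M) _          = A≈M
InR⁼-antisym {M} p A (inj₂ _)   (inj₁ M≈A) = ≈-sym M A M≈A
InR⁼-antisym {M} p A (inj₂ MA)  (inj₂ AM)  = ⊥-elim (InR-irrefl p (P∈-closedʳ p A MA M AM))

InR⁼-InL⁼-unique : ∀ {M} → P∈ M → ∀ A → InR⁼ M A → InL⁼ M A → A ≈ M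
InR⁼-InL⁼-unique p A (inj₁ A≈M) _          = A≈M
InR⁼-InL⁼-unique p A (inj₂ _)   (inj₁ A≈M) = A≈M
InR⁼-InL⁼-unique p A (inj₂ MA)  (inj₂ MA′) = ⊥-elim (P∈-disjoint p A MA′ MA)

P∈-meet⁼ : ∀ {M} → P∈ M → ∀ A B → InL⁼ M A → InR⁼ M B → Meet A B
P∈-meet⁼ {M} p A B (inj₁ A≈M) (inj₁ B≈M) =
  A , inj₁ (≈-refl A) , inj₁ (≈-trans A M B A≈M (≈-sym B M B≈M))
P∈-meet⁼ {M} p A B (inj₁ A≈M) (inj₂ MB) =
  B , inj₂ (InR-respˡ M A B (≈-sym A M A≈M) MB) , inj₁ (≈-refl B)
P∈-meet⁼ {M} p A B (inj₂ MA) (inj₁ B≈M) =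
  A , inj₁ (≈-refl A) , inj₂ (InL-respˡ M B A (≈-sym B M B≈M) MA)
P∈-meet⁼ {M} p A B (inj₂ MA) (inj₂ MB) = P∈-meet p A B MA MB

≈⇒Meet : ∀ M N → M ≈ N → Meet M N
≈⇒Meet M N M≈N = M , inj₁ (≈-refl M) , inj₁ M≈N

Meet-trans : ∀ {M N K} → P∈ M → P∈ N → P∈ K → Meet M N → Meet N K → Meet M K
Meet-trans p q r (C , MC , NC) (D , ND , KD) =
  let E , CE , DE = P∈-meet⁼ q C D NC ND
  in  E , InR⁼-trans p C E MC CE , InL⁼-trans r D E KD DE

Meet-antisym : ∀ {M N} → P∈ M → P∈ N → Meet M N → Meet N M → M ≈ N
Meet-antisym {M} {N} p q (C , MC , NC) (D , ND , MD) = ≈-trans M D N (≈-sym D M D≈M) D≈N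
  where
  D≈M : D ≈ M
  D≈M =
    let E , CE , DE = P∈-meet⁼ q C D NC ND
        E≈M = InR⁼-InL⁼-unique p E (InR⁼-trans p C E MC CE) (InL⁼-trans p D E MD DE)
    in  InL⁼-antisym p D MD (InL⁼-respʳ D E M E≈M DE)

  D≈N : D ≈ N
  D≈N =
    let F , DF , CF = P∈-meet⁼ p D C MD MC
        F≈N = InR⁼-InL⁼-unique q F (InR⁼-trans q D F ND DF) (InL⁼-trans q C F NC CF)
    in  InR⁼-antisym q D ND (InR⁼-respʳ D F N F≈N DF)

≤∈⇒<∈ : ∀ M N → M ≤∈ N → M <∈ N
≤∈⇒<∈ M N (inj₁ M<N) = M<N
≤∈⇒<∈ M N (inj₂ M≈N) = ≈⇒Meet (proj₁ M) (proj₁ N) M≈N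

mainTheorem12 : IsPartialOrder _≈𝒫_ _≤∈_
mainTheorem12 = record
  { isPreorder = record
    { isEquivalence = On.isEquivalence proj₁ ≈-isEquivalence
    ; reflexive     = inj₂
    ; trans         = λ {M} {N} {K} M≤N N≤K →
        inj₁ (Meet-trans (proj₂ M) (proj₂ N) (proj₂ K) (≤∈⇒<∈ M N M≤N) (≤∈⇒<∈ N K N≤K))
    }
  ; antisym = λ {M} {N} M≤N N≤M →
      Meet-antisym (proj₂ M) (proj₂ N) (≤∈⇒<∈ M N M≤N) (≤∈⇒<∈ N M N≤M)
  }
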